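{- Let $(X,T)$ be a minimal and aperiodic subshift, and let $(\gamma_n:A_{n+1}^*\to A_n^*)_{n\in\mathbb N}$ be the sequence of morphisms associated with a sequence $(U_n)_n$ and bijections $(\theta_n)_n$ as described in the context. Then for every non-negative integer $r$ there exist an integer $s>r$ and a letter $a\in A_r$ such that $\gamma_r\gamma_{r+1}\cdots\gamma_s(A_{s+1})\subseteq A_r^*a$.
   Context: $\mathcal L(X)$ is the language of $X$, $\mathcal L_n(X)$ its words of length $n$; $u$ is right special if $ua,ub\in\mathcal L(X)$ for distinct letters $a,b$. The Rauzy graph $G_n$ has vertices $\mathcal L_n(X)$ and an edge from $u$ to $v$ with right label $b$ whenever $ub=av\in\mathcal L_{n+1}(X)$ for letters $a,b$; for a path $p=(u_0\to u_1\to\cdots\to u_\ell)$ with right labels $b_1,\dots,b_\ell$, $\lambda_R(p)=b_1\cdots b_\ell$, $\lambda(p)=u_0b_1\cdots b_\ell$, and $p$ is allowed if $\lambda(p)\in\mathcal L(X)$; $o(p)=u_0$, $i(p)=u_\ell$. An $n$-circuit is a non-empty path in $G_n$ with $o(p)=i(p)$ right special and no interior vertex equal to $o(p)$. Fix a sequence $(U_n)_{n\in\mathbb N}$ of right special factors with $U_n\in\mathcal L_n(X)$ and $U_n$ a suffix of $U_{n+1}$. Let $\mathcal A_n$ be the (finite) set of allowed $n$-circuits starting from $U_n$, $A_n=\{0,1,\dots,\#\mathcal A_n-1\}$, and $\theta_n:A_n\to\mathcal A_n$ a bijection, extended to words by concatenation of paths. For a path $p$ of $G_{n+1}$, $\psi_n(p)$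 is the unique path $q$ of $G_n$ with $\lambda_R(q)=\lambda_R(p)$ and $o(q),i(q)$ suffixes of $o(p),i(p)$. For $a\in A_{n+1}$, the path $\psi_n(\theta_{n+1}(a))$ is a concatenation $\theta_n(b_1)\cdots\theta_n(b_k)$ of allowed $n$-circuits from $U_n$, and $\gamma_n$ is the unique morphism with $\theta_n\gamma_n=\psi_n\theta_{n+1}$, i.e. $\gamma_n(a)=b_1\cdots b_k$. -}

module Defs where

open import Data.Nat using (ℕ; zero; suc; _+_; _<_; _>_)
open import Data.Integer as ℤ using (ℤ; +_; -_)
open import Data.Fin using (Fin)
open import Data.List using (List; []; _∷_; _++_; [_]; length; take; drop; concatMap)
open import Data.Product using (Σ; _×_; ∃; ∃-syntax; _,_)
open import Relation.Binary.PropositionalEquality using (_≡_; _≢_)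
open import Relation.Nullary using (¬_)

Point : ℕ → Set
Point m = ℤ → Fin m

shift : ∀ {m} → Point m → Point m
shift x i = x (i ℤ.+ + 1)

shiftInv : ∀ {m} → Point m → Point m
shiftInv x i = x (i ℤ.- + 1)

PointSet : ℕ → Set₁
PointSet m = Point m → Set

NonEmpty : ∀ {m} → PointSet m → Set
NonEmpty X = ∃[ x ] X x

-- Closed in the product topology: any point agreeing on every central
-- window [-N,N] with some point of X lies in X.
Closed : ∀ {m} → PointSet m → Set
Closed X = ∀ y → (∀ (N : ℕ) → ∃[ x ] (X x × (∀ (i : ℤ) → ℤ.∣ i ∣ Data.Nat.≤ N → x i ≡ y i))) → X y

ShiftInvariant : ∀ {m} → PointSet m → Set
ShiftInvariant X = (∀ x → X x → X (shift x)) × (∀ x → X x → X (shiftInv x))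

IsSubshift : ∀ {m} → PointSet m → Set
IsSubshift X = NonEmpty X × Closed X × ShiftInvariant X

_⊆_ : ∀ {m} → PointSet m → PointSet m → Set
Y ⊆ X = ∀ x → Y x → X x

Minimal : ∀ {m} → PointSet m → Set₁
Minimal {m} X = (Y : PointSet m) → Y ⊆ X → NonEmpty Y → Closed Y → ShiftInvariant Y → X ⊆ Y

Aperiodic : ∀ {m} → PointSet m → Set
Aperiodic X = ∀ x → X x → ∀ (p : ℕ) → p > 0 → ¬ (∀ (i : ℤ) → x (i ℤ.+ + p) ≡ x i)

window : ∀ {m} → Point m → ℤ → ℕ → List (Fin m)
window x i zero = []
window x i (suc n) = x i ∷ window x (i ℤ.+ + 1) n

Lang : ∀ {m} → PointSet m → List (Fin m) → Set
Lang X w = ∃[ x ] (X x × ∃[ i ] (window x i (length w) ≡ w))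

RightSpecial : ∀ {m} → PointSet m → List (Fin m) → Set
RightSpecial X u = ∃[ a ] ∃[ b ] (a ≢ b × Lang X (u ++ [ a ]) × Lang X (u ++ [ b ]))

-- A path of the Rauzy graph G_n with origin u (|u| = n) is determined by
-- its list of right labels bs; its label is λ(p) = u ++ bs, and its
-- vertex after i steps is the length-n suffix of u ++ take i bs,
-- i.e. drop i (u ++ take i bs).
vertexAt : ∀ {m} → List (Fin m) → List (Fin m) → ℕ → List (Fin m)
vertexAt u bs i = drop i (u ++ take i bs)

-- bs are the right labels of an allowed n-circuit starting from u:
-- non-empty, allowed (λ(p) ∈ L(X), which also makes it a path of G_n),
-- ends at u, and no interior vertex equals u.
AllowedCircuitFrom : ∀ {m} → PointSet m → List (Fin m) → List (Fin m) → Set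
AllowedCircuitFrom X u bs =
  bs ≢ [] × Lang X (u ++ bs) × vertexAt u bs (length bs) ≡ u
  × (∀ i → 0 < i → i < length bs → vertexAt u bs i ≢ u)

-- Composition γ_r γ_{r+1} ⋯ γ_{d+r} : A_{suc (d + r)}* → A_r*, on letters.
gammaComp : (k : ℕ → ℕ) (γ : (n : ℕ) → Fin (k (suc n)) → List (Fin (k n)))
  (r d : ℕ) → Fin (k (suc (d + r))) → List (Fin (k r))
gammaComp k γ r zero = γ r
gammaComp k γ r (suc d) c = concatMap (gammaComp k γ r d) (γ (suc (d + r)) c)

-- By minimality every word of L(X) occurs in a single point, so the right
-- special factor U_N occurs twice in it and its first return there is an
-- N-circuit; in particular A_N is non-empty.  Take N = r + d + 1 with d
-- longer than every r-circuit.  For c ∈ A_N the circuit θ_N(c) is the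
-- concatenation of the r-circuits θ_r(b), b running over γ_r ⋯ γ_{N-1}(c),
-- and it returns to U_N, which ends with U_r; hence U_r θ_r(a) is a suffix
-- of U_N for the last letter a.  Two distinct r-circuits cannot both give
-- such a suffix, since the longer one would pass through U_r at an interior
-- vertex.  So a does not depend on c.

module Submission where

open import Defs
open import Data.Nat using (ℕ; zero; suc; _+_; _>_; _≤_; _<_; z≤n; s≤s; z<s; s<s⁻¹)
open import Data.Nat.Properties using (<⇒≱; m≤n+m; ≤-refl; ≤-trans; ≤-total; <⇒≤; n≤1+n; m<m+n; +-comm; +-monoʳ-≤; +-cancelˡ-≡; anyUpTo?; module ≤-Reasoning)
open import Data.Nat.Induction using (<-wellFounded)
open import Algebra.Properties.CommutativeSemigroup Data.Nat.Properties.+-commutativeSemigroup using (x∙yz≈y∙xz)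
open import Data.Integer as ℤ using (ℤ; +_)
import Data.Integer.Properties as ℤP
open import Data.Integer.Tactic.RingSolver using (solve-∀)
open import Data.Fin using (Fin)
import Data.Fin.Properties as FinP
open import Data.List using (List; []; _∷_; _++_; [_]; _∷ʳ_; length; concatMap; take; drop; tabulate; initLast; _∷ʳ′_)
open import Data.List.Properties using (length-++; ++-assoc; ++-identityʳ; ++-cancelˡ; concatMap-++; concatMap-cong; take++drop≡id; take-all; ∷ʳ-injective; ∷-injectiveʳ; ≡-dec)
open import Data.List.Extrema.Nat using (max; xs≤max)
import Data.List.Relation.Unary.All as All
open import Data.List.Membership.Propositional.Properties using (∈-tabulate⁺)
open import Data.Product using (_×_; ∃-syntax; _,_; proj₁; proj₂)
open import Data.Sum using (inj₁; inj₂)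
open import Data.Empty using (⊥-elim)
open import Function using (_∘_)
open import Induction.WellFounded using (Acc; acc)
open import Relation.Nullary using (¬_; yes; no)
open import Relation.Unary using (Decidable)
open import Relation.Binary.PropositionalEquality using (_≡_; _≢_; refl; sym; trans; cong; cong₂; subst; subst₂; module ≡-Reasoning)

≤-max-tabulate : ∀ {n} (f : Fin n → ℕ) i → f i ≤ max 0 (tabulate f)
≤-max-tabulate f i = All.lookup (xs≤max 0 (tabulate f)) (∈-tabulate⁺ i)

least-witness : {P : ℕ → Set} → Decidable P → ∀ {n} → P n → ∃[ i ] (P i × (∀ {j} → j < i → ¬ P j))
least-witness {P} P? {n} = search n (<-wellFounded n)
  where
  search : ∀ n → Acc _<_ n → P n → ∃[ i ] (P i × (∀ {j} → j < i → ¬ P j))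
  search n (acc smaller) Pn with anyUpTo? P? n
  ... | yes (j , j<n , Pj) = search j (smaller j<n) Pj
  ... | no none            = n , Pn , λ j<n Pj → none (_ , j<n , Pj)

i+[j-i]≡j : ∀ i j → i ℤ.+ (j ℤ.- i) ≡ j
i+[j-i]≡j = solve-∀

[i+1]-1≡[i-1]+1 : ∀ i → (i ℤ.+ + 1) ℤ.- + 1 ≡ (i ℤ.- + 1) ℤ.+ + 1
[i+1]-1≡[i-1]+1 = solve-∀

≤⇒≡+ : ∀ {i j : ℤ} → i ℤ.≤ j → ∃[ t ] (j ≡ i ℤ.+ + t)
≤⇒≡+ {i} {j} i≤j = ℤ.∣ j ℤ.- i ∣ , (begin
  j                       ≡⟨ i+[j-i]≡j i j ⟨
  i ℤ.+ (j ℤ.- i)         ≡⟨ cong (λ t → i ℤ.+ t) (ℤP.0≤i⇒+∣i∣≡i (ℤP.i≤j⇒0≤j-i i≤j)) ⟨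
  i ℤ.+ + ℤ.∣ j ℤ.- i ∣  ∎)
  where open ≡-Reasoning

+-+-assoc : ∀ (i : ℤ) a b → (i ℤ.+ + a) ℤ.+ + b ≡ i ℤ.+ + (a + b)
+-+-assoc i a b = trans (ℤP.+-assoc i (+ a) (+ b)) (cong (λ t → i ℤ.+ t) (sym (ℤP.pos-+ a b)))

module _ {A : Set} where

  _IsSuffixOf_ : List A → List A → Set
  xs IsSuffixOf ys = ∃[ zs ] (ys ≡ zs ++ xs)

  -- The path of a Rauzy graph labelled s from u ends at u.
  ReturnsTo : List A → List A → Set
  ReturnsTo u s = u IsSuffixOf (u ++ s)

  suffix-++ˡ : ∀ {xs ys} zs → xs IsSuffixOf ys → xs IsSuffixOf (zs ++ ys)
  suffix-++ˡ {xs} zs (rs , refl) = zs ++ rs , sym (++-assoc zs rs xs)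

  ++-suffix : ∀ (as bs cs ds : List A) → as ++ bs ≡ cs ++ ds → length ds ≤ length bs → ds IsSuffixOf bs
  ++-suffix []       bs cs       ds eq ds≤bs = cs , eq
  ++-suffix (a ∷ as) bs []       ds refl ds≤bs =
    ⊥-elim (<⇒≱ (s≤s (subst (length bs ≤_) (sym (length-++ as)) (m≤n+m (length bs) (length as)))) ds≤bs)
  ++-suffix (a ∷ as) bs (c ∷ cs) ds eq ds≤bs = ++-suffix as bs cs ds (∷-injectiveʳ eq) ds≤bs

  length-++-monoʳ : ∀ (us : List A) {vs ws : List A} → length vs ≤ length ws → length (us ++ vs) ≤ length (us ++ ws)
  length-++-monoʳ us vs≤ws = subst₂ _≤_ (sym (length-++ us)) (sym (length-++ us)) (+-monoʳ-≤ (length us) vs≤ws)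

  drop-length-++ : ∀ (xs ys : List A) → drop (length xs) (xs ++ ys) ≡ ys
  drop-length-++ []       ys = refl
  drop-length-++ (x ∷ xs) ys = drop-length-++ xs ys

  take-length-++ : ∀ (xs ys : List A) → take (length xs) (xs ++ ys) ≡ xs
  take-length-++ []       ys = refl
  take-length-++ (x ∷ xs) ys = cong (x ∷_) (take-length-++ xs ys)

  take-length+-++ : ∀ (xs : List A) n ys → take (length xs + n) (xs ++ ys) ≡ xs ++ take n ys
  take-length+-++ []       n ys = refl
  take-length+-++ (x ∷ xs) n ys = cong (x ∷_) (take-length+-++ xs n ys)

  ≢[]⇒∷ʳ : ∀ (xs : List A) → xs ≢ [] → ∃[ ys ] ∃[ y ] (xs ≡ ys ∷ʳ y)
  ≢[]⇒∷ʳ xs xs≢[] with initLast xs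
  ... | []        = ⊥-elim (xs≢[] refl)
  ... | ys ∷ʳ′ y = ys , y , refl

  returns-++ : ∀ {u s t} → ReturnsTo u s → ReturnsTo u t → ReturnsTo u (s ++ t)
  returns-++ {u} {s} {t} (qs , us≡) (zs , ut≡) = qs ++ zs , (begin
    u ++ (s ++ t)     ≡⟨ ++-assoc u s t ⟨
    (u ++ s) ++ t     ≡⟨ cong (_++ t) us≡ ⟩
    (qs ++ u) ++ t    ≡⟨ ++-assoc qs u t ⟩
    qs ++ (u ++ t)    ≡⟨ cong (qs ++_) ut≡ ⟩
    qs ++ (zs ++ u)   ≡⟨ ++-assoc qs zs u ⟨
    (qs ++ zs) ++ u   ∎)
    where open ≡-Reasoning

  concatMap-returns : ∀ {I : Set} {u} (f : I → List A) → (∀ i → ReturnsTo u (f i)) → ∀ w → ReturnsTo u (concatMap f w)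
  concatMap-returns {u = u} f ret []      = [] , ++-identityʳ u
  concatMap-returns         f ret (i ∷ w) = returns-++ (ret i) (concatMap-returns f ret w)

  returns-last : ∀ {I : Set} {u} (f : I → List A) → (∀ i → ReturnsTo u (f i)) → ∀ w a
    → (u ++ f a) IsSuffixOf (u ++ concatMap f (w ∷ʳ a))
  returns-last {u = u} f ret w a with concatMap-returns f ret w
  ... | zs , eq = zs , (begin
    u ++ concatMap f (w ++ [ a ])      ≡⟨ cong (u ++_) (concatMap-++ f w [ a ]) ⟩
    u ++ (concatMap f w ++ (f a ++ [])) ≡⟨ cong (λ v → u ++ (concatMap f w ++ v)) (++-identityʳ (f a)) ⟩
    u ++ (concatMap f w ++ f a)         ≡⟨ ++-assoc u _ (f a) ⟨
    (u ++ concatMap f w) ++ f a         ≡⟨ cong (_++ f a) eq ⟩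
    (zs ++ u) ++ f a                    ≡⟨ ++-assoc zs u (f a) ⟩
    zs ++ (u ++ f a)                    ∎)
    where open ≡-Reasoning

suffix-chain : ∀ {A : Set} (U : ℕ → List A) → (∀ n → ∃[ c ] (U (suc n) ≡ c ∷ U n)) → ∀ e n → U n IsSuffixOf U (e + n)
suffix-chain U grows zero    n = [] , refl
suffix-chain U grows (suc e) n with suffix-chain U grows e n | grows (e + n)
... | vs , eq | c , grow = c ∷ vs , trans grow (cong (c ∷_) eq)

last-block-suffix : ∀ {A I : Set} {u v : List A} (f : I → List A) → (∀ i → ReturnsTo u (f i)) → u IsSuffixOf v
  → (∀ i → length (u ++ f i) ≤ length v) → ∀ w → w ≢ [] → ReturnsTo v (concatMap f w)
  → ∃[ w′ ] ∃[ a ] (w ≡ w′ ∷ʳ a × (u ++ f a) IsSuffixOf v)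
last-block-suffix {u = u} f returns (vs , refl) fits w w≢[] (qs , eq) with ≢[]⇒∷ʳ w w≢[]
... | w′ , a , refl with suffix-++ˡ vs (returns-last f returns w′ a)
...   | rs , eq′ = w′ , a , refl , ++-suffix qs (vs ++ u) rs (u ++ f a) (trans (sym eq) (trans (++-assoc vs u _) eq′)) (fits a)

module _ {m : ℕ} (x : Point m) where

  length-window : ∀ i n → length (window x i n) ≡ n
  length-window i zero    = refl
  length-window i (suc n) = cong suc (length-window (i ℤ.+ + 1) n)

  window-+ : ∀ i a b → window x i (a + b) ≡ window x i a ++ window x (i ℤ.+ + a) b
  window-+ i zero    b = cong (λ j → window x j b) (sym (ℤP.+-identityʳ i))
  window-+ i (suc a) b = cong (x i ∷_) (trans (window-+ (i ℤ.+ + 1) a b)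
    (cong (λ j → window x (i ℤ.+ + 1) a ++ window x j b) (+-+-assoc i 1 a)))

  take-window : ∀ i {q k} → q ≤ k → take q (window x i k) ≡ window x i q
  take-window i z≤n       = refl
  take-window i (s≤s q≤k) = cong (x i ∷_) (take-window (i ℤ.+ + 1) q≤k)

  drop-window-++ : ∀ i q ys → drop q (window x i q ++ ys) ≡ ys
  drop-window-++ i zero    ys = refl
  drop-window-++ i (suc q) ys = drop-window-++ (i ℤ.+ + 1) q ys

  occurrence-∷ʳ : ∀ {i u c} → window x i (length (u ∷ʳ c)) ≡ u ∷ʳ c
    → window x i (length u) ≡ u × x (i ℤ.+ + length u) ≡ c
  occurrence-∷ʳ {i} {u} {c} occ = ∷ʳ-injective (window x i (length u)) u (begin
    window x i (length u) ∷ʳ x (i ℤ.+ + length u) ≡⟨ window-+ i (length u) 1 ⟨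
    window x i (length u + 1)                     ≡⟨ cong (window x i) (length-++ u) ⟨
    window x i (length (u ∷ʳ c))                  ≡⟨ occ ⟩
    u ∷ʳ c                                        ∎)
    where open ≡-Reasoning

  vertexAt-window : ∀ {u} i → window x i (length u) ≡ u → ∀ {q k} → q ≤ k
    → vertexAt u (window x (i ℤ.+ + length u) k) q ≡ window x (i ℤ.+ + q) (length u)
  vertexAt-window {u} i occ {q} {k} q≤k = begin
    drop q (u ++ take q (window x (i ℤ.+ + n) k))
      ≡⟨ cong₂ (λ v w → drop q (v ++ w)) (sym occ) (take-window (i ℤ.+ + n) q≤k) ⟩
    drop q (window x i n ++ window x (i ℤ.+ + n) q) ≡⟨ cong (drop q) (window-+ i n q) ⟨
    drop q (window x i (n + q))                     ≡⟨ cong (drop q ∘ window x i) (+-comm n q) ⟩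
    drop q (window x i (q + n))                     ≡⟨ cong (drop q) (window-+ i q n) ⟩
    drop q (window x i q ++ window x (i ℤ.+ + q) n) ≡⟨ drop-window-++ i q _ ⟩
    window x (i ℤ.+ + q) n                          ∎
    where
    n = length u
    open ≡-Reasoning

  window-cong : ∀ (y : Point m) i n → (∀ t → t < n → x (i ℤ.+ + t) ≡ y (i ℤ.+ + t)) → window x i n ≡ window y i n
  window-cong y i zero    agree = refl
  window-cong y i (suc n) agree = cong₂ _∷_
    (subst (λ j → x j ≡ y j) (ℤP.+-identityʳ i) (agree 0 z<s))
    (window-cong y (i ℤ.+ + 1) n λ t t<n →
      subst (λ j → x j ≡ y j) (sym (+-+-assoc i 1 t)) (agree (suc t) (s≤s t<n)))

  window-shift : ∀ i n → window (shift x) i n ≡ window x (i ℤ.+ + 1) n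
  window-shift i zero    = refl
  window-shift i (suc n) = cong (x (i ℤ.+ + 1) ∷_) (window-shift (i ℤ.+ + 1) n)

  window-shiftInv : ∀ i n → window (shiftInv x) i n ≡ window x (i ℤ.- + 1) n
  window-shiftInv i zero    = refl
  window-shiftInv i (suc n) = cong (x (i ℤ.- + 1) ∷_)
    (trans (window-shiftInv (i ℤ.+ + 1) n) (cong (λ j → window x j n) ([i+1]-1≡[i-1]+1 i)))

_WindowsOccurIn_ : ∀ {m} → Point m → Point m → Set
y WindowsOccurIn x₀ = ∀ i n → ∃[ j ] (window y i n ≡ window x₀ j n)

module _ {m : ℕ} {X : PointSet m} (subshift : IsSubshift X) (minimal : Minimal X) where

  private
    closed : Closed X
    closed = proj₁ (proj₂ subshift)

    invariant : ShiftInvariant X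
    invariant = proj₂ (proj₂ subshift)

  -- Minimality applied to the subshift of the points of X all of whose
  -- windows occur in x₀.
  windows-occur-everywhere : ∀ {x₀} → X x₀ → ∀ y → X y → y WindowsOccurIn x₀
  windows-occur-everywhere {x₀} Xx₀ y Xy =
    proj₂ (minimal Y (λ _ → proj₁) (x₀ , Xx₀ , λ i n → i , refl) Y-closed (Y-shift , Y-shiftInv) y Xy)
    where
    Y : PointSet m
    Y y = X y × y WindowsOccurIn x₀

    Y-closed : Closed Y
    Y-closed y approx = closed y (λ N → let (z , (Xz , _) , agree) = approx N in z , Xz , agree) , occurs
      where
      occurs : y WindowsOccurIn x₀
      occurs i n with approx (ℤ.∣ i ∣ + n)
      ... | z , (_ , z-occurs) , agree with z-occurs i n
      ...   | j , eq = j , trans (sym (window-cong z y i n λ t t<n → agree (i ℤ.+ + t)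
                (≤-trans (ℤP.∣i+j∣≤∣i∣+∣j∣ i (+ t)) (+-monoʳ-≤ ℤ.∣ i ∣ (<⇒≤ t<n))))) eq

    Y-shift : ∀ y → Y y → Y (shift y)
    Y-shift y (Xy , y-occurs) = proj₁ invariant y Xy , λ i n →
      let (j , eq) = y-occurs (i ℤ.+ + 1) n in j , trans (window-shift y i n) eq

    Y-shiftInv : ∀ y → Y y → Y (shiftInv y)
    Y-shiftInv y (Xy , y-occurs) = proj₂ invariant y Xy , λ i n →
      let (j , eq) = y-occurs (i ℤ.- + 1) n in j , trans (window-shiftInv y i n) eq

  language-occurs-everywhere : ∀ {x₀} → X x₀ → ∀ {w} → Lang X w → ∃[ j ] (window x₀ j (length w) ≡ w)
  language-occurs-everywhere Xx₀ {w} (y , Xy , i , occ) with windows-occur-everywhere Xx₀ y Xy i (length w)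
  ... | j , eq = j , trans (sym eq) occ

module _ {m : ℕ} {X : PointSet m} where

  circuit⇒returns : ∀ {u bs} → AllowedCircuitFrom X u bs → ReturnsTo u bs
  circuit⇒returns {u} {bs} (_ , _ , ends , _) = take ℓ (u ++ bs) , (begin
    u ++ bs                              ≡⟨ take++drop≡id ℓ (u ++ bs) ⟨
    take ℓ (u ++ bs) ++ drop ℓ (u ++ bs) ≡⟨ cong (λ v → take ℓ (u ++ bs) ++ drop ℓ (u ++ v)) (take-all ℓ bs ≤-refl) ⟨
    take ℓ (u ++ bs) ++ vertexAt u bs ℓ  ≡⟨ cong (take ℓ (u ++ bs) ++_) ends ⟩
    take ℓ (u ++ bs) ++ u                ∎)
    where
    ℓ = length bs
    open ≡-Reasoning

  return⇒circuit : ∀ {x u} → X x → ∀ i e → window x i (length u) ≡ u → window x (i ℤ.+ + suc e) (length u) ≡ u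
    → ∃[ bs ] AllowedCircuitFrom X u bs
  return⇒circuit {x} {u} Xx i e occ returns
    with least-witness (λ e → ≡-dec FinP._≟_ (window x (i ℤ.+ + suc e) (length u)) u) returns
  ... | e₀ , first-return , no-earlier = bs , (λ ()) , allowed , ends , avoids
    where
    n = length u
    bs = window x (i ℤ.+ + n) (suc e₀)

    |bs| : length bs ≡ suc e₀
    |bs| = length-window x (i ℤ.+ + n) (suc e₀)

    allowed : Lang X (u ++ bs)
    allowed = x , Xx , i , (begin
      window x i (length (u ++ bs)) ≡⟨ cong (window x i) (trans (length-++ u) (cong (λ l → n + l) |bs|)) ⟩
      window x i (n + suc e₀)       ≡⟨ window-+ x i n (suc e₀) ⟩
      window x i n ++ bs            ≡⟨ cong (_++ bs) occ ⟩
      u ++ bs                       ∎)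
      where open ≡-Reasoning

    ends : vertexAt u bs (length bs) ≡ u
    ends = trans (cong (vertexAt u bs) |bs|) (trans (vertexAt-window x i occ ≤-refl) first-return)

    avoids : ∀ q → 0 < q → q < length bs → vertexAt u bs q ≢ u
    avoids (suc q) _ q<|bs| = no-earlier (s<s⁻¹ q<) ∘ trans (sym (vertexAt-window x i occ (<⇒≤ q<)))
      where
      q< : suc q < suc e₀
      q< = subst (suc q <_) |bs| q<|bs|

  ordered-occurrences⇒circuit : ∀ {x u i j} → X x → window x i (length u) ≡ u → window x j (length u) ≡ u
    → i ≢ j → i ℤ.≤ j → ∃[ bs ] AllowedCircuitFrom X u bs
  ordered-occurrences⇒circuit {i = i} Xx occᵢ occⱼ i≢j i≤j with ≤⇒≡+ i≤j
  ... | zero  , j≡i+0 = ⊥-elim (i≢j (sym (trans j≡i+0 (ℤP.+-identityʳ i))))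
  ... | suc e , refl  = return⇒circuit Xx i e occᵢ occⱼ

  occurrences⇒circuit : ∀ {x u i j} → X x → window x i (length u) ≡ u → window x j (length u) ≡ u
    → i ≢ j → ∃[ bs ] AllowedCircuitFrom X u bs
  occurrences⇒circuit {i = i} {j} Xx occᵢ occⱼ i≢j with ℤP.≤-total i j
  ... | inj₁ i≤j = ordered-occurrences⇒circuit Xx occᵢ occⱼ i≢j i≤j
  ... | inj₂ j≤i = ordered-occurrences⇒circuit Xx occⱼ occᵢ (i≢j ∘ sym) j≤i

  vertexAt-occurrence : ∀ {u bs : List (Fin m)} (qs vs : List (Fin m)) → u ++ bs ≡ qs ++ (u ++ vs) → vertexAt u bs (length qs) ≡ u
  vertexAt-occurrence {u} {bs} qs vs eq = begin
    drop ℓ (u ++ take ℓ bs)                          ≡⟨ cong (drop ℓ) (take-length+-++ u ℓ bs) ⟨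
    drop ℓ (take (length u + ℓ) (u ++ bs))           ≡⟨ cong (drop ℓ ∘ take (length u + ℓ)) eq ⟩
    drop ℓ (take (length u + ℓ) (qs ++ (u ++ vs)))   ≡⟨ cong (λ l → drop ℓ (take l (qs ++ (u ++ vs)))) (+-comm (length u) ℓ) ⟩
    drop ℓ (take (ℓ + length u) (qs ++ (u ++ vs)))   ≡⟨ cong (drop ℓ) (take-length+-++ qs (length u) (u ++ vs)) ⟩
    drop ℓ (qs ++ take (length u) (u ++ vs))         ≡⟨ cong (λ v → drop ℓ (qs ++ v)) (take-length-++ u vs) ⟩
    drop ℓ (qs ++ u)                                 ≡⟨ drop-length-++ qs u ⟩
    u                                                ∎
    where
    ℓ = length qs
    open ≡-Reasoning

  -- A proper suffix u ++ bs of u ++ bs′ would make the circuit bs′ visit u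
  -- after |bs′| - |bs| steps.
  circuit-suffix⇒≡ : ∀ {u bs bs′} → AllowedCircuitFrom X u bs → AllowedCircuitFrom X u bs′
    → (u ++ bs) IsSuffixOf (u ++ bs′) → bs ≡ bs′
  circuit-suffix⇒≡ {u} {bs} {bs′} _ _ ([] , eq) = sym (++-cancelˡ u bs′ bs eq)
  circuit-suffix⇒≡ {u} {bs} {bs′} (bs≢[] , _) (_ , _ , _ , avoids′) (qs@(_ ∷ _) , eq) =
    ⊥-elim (avoids′ (length qs) z<s |qs|<|bs′| (vertexAt-occurrence qs bs eq))
    where
    open ≡-Reasoning

    |bs′|≡ : length bs′ ≡ length qs + length bs
    |bs′|≡ = +-cancelˡ-≡ (length u) _ _ (begin
      length u + length bs′                ≡⟨ length-++ u ⟨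
      length (u ++ bs′)                    ≡⟨ cong length eq ⟩
      length (qs ++ (u ++ bs))             ≡⟨ length-++ qs ⟩
      length qs + length (u ++ bs)         ≡⟨ cong (λ l → length qs + l) (length-++ u) ⟩
      length qs + (length u + length bs)   ≡⟨ x∙yz≈y∙xz (length qs) (length u) (length bs) ⟩
      length u + (length qs + length bs)   ∎)

    |qs|<|bs′| : length qs < length bs′
    |qs|<|bs′| = subst (length qs <_) (sym |bs′|≡) (m<m+n (length qs) (non-empty bs bs≢[]))
      where
      non-empty : ∀ (xs : List (Fin m)) → xs ≢ [] → 0 < length xs
      non-empty []      xs≢[] = ⊥-elim (xs≢[] refl)
      non-empty (_ ∷ _) _     = z<s

  circuit-suffix-unique : ∀ {u bs bs′ w} → AllowedCircuitFrom X u bs → AllowedCircuitFrom X u bs′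
    → (u ++ bs) IsSuffixOf w → (u ++ bs′) IsSuffixOf w → bs ≡ bs′
  circuit-suffix-unique {u} {bs} {bs′} c c′ (rs , w≡) (rs′ , w≡′) with ≤-total (length bs) (length bs′)
  ... | inj₁ ≤ = circuit-suffix⇒≡ c c′ (++-suffix rs′ (u ++ bs′) rs (u ++ bs) (trans (sym w≡′) w≡) (length-++-monoʳ u ≤))
  ... | inj₂ ≥ = sym (circuit-suffix⇒≡ c′ c (++-suffix rs (u ++ bs) rs′ (u ++ bs′) (trans (sym w≡) w≡′) (length-++-monoʳ u ≥)))

rightSpecial⇒circuit : ∀ {m} {X : PointSet m} → IsSubshift X → Minimal X → ∀ {u} → RightSpecial X u
  → ∃[ bs ] AllowedCircuitFrom X u bs
rightSpecial⇒circuit subshift minimal (a , b , a≢b , ua@(x₀ , Xx₀ , _) , ub)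
  with language-occurs-everywhere subshift minimal Xx₀ ua | language-occurs-everywhere subshift minimal Xx₀ ub
... | i , occa | j , occb with occurrence-∷ʳ x₀ occa | occurrence-∷ʳ x₀ occb
... | occᵢ , xa | occⱼ , xb = occurrences⇒circuit Xx₀ occᵢ occⱼ λ { refl → a≢b (trans (sym xa) xb) }

concatMap-concatMap : ∀ {A B C : Set} (f : B → List C) (g : A → List B) xs
  → concatMap f (concatMap g xs) ≡ concatMap (concatMap f ∘ g) xs
concatMap-concatMap f g []       = refl
concatMap-concatMap f g (x ∷ xs) =
  trans (concatMap-++ f (g x) (concatMap g xs)) (cong (concatMap f (g x) ++_) (concatMap-concatMap f g xs))

concatMap-gammaComp : ∀ {A : Set} (k : ℕ → ℕ) (γ : (n : ℕ) → Fin (k (suc n)) → List (Fin (k n)))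
  (θ : (n : ℕ) → Fin (k n) → List A) → (∀ n a → concatMap (θ n) (γ n a) ≡ θ (suc n) a)
  → ∀ r d c → concatMap (θ r) (gammaComp k γ r d c) ≡ θ (suc (d + r)) c
concatMap-gammaComp k γ θ θγ r zero    c = θγ r c
concatMap-gammaComp k γ θ θγ r (suc d) c = begin
  concatMap (θ r) (concatMap (gammaComp k γ r d) (γ s c)) ≡⟨ concatMap-concatMap (θ r) (gammaComp k γ r d) (γ s c) ⟩
  concatMap (concatMap (θ r) ∘ gammaComp k γ r d) (γ s c) ≡⟨ concatMap-cong (concatMap-gammaComp k γ θ θγ r d) (γ s c) ⟩
  concatMap (θ s) (γ s c)                                 ≡⟨ θγ s c ⟩
  θ (suc s) c                                             ∎
  where
  s = suc (d + r)
  open ≡-Reasoning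

lemma3p13 : (m : ℕ) (X : PointSet m) → IsSubshift X → Minimal X → Aperiodic X
    → (U : ℕ → List (Fin m))
    → (∀ n → length (U n) ≡ n)
    → (∀ n → RightSpecial X (U n))
    → (∀ n → ∃[ c ] (U (suc n) ≡ c ∷ U n))
    → (k : ℕ → ℕ) (θ : (n : ℕ) → Fin (k n) → List (Fin m))
    → (∀ n i → AllowedCircuitFrom X (U n) (θ n i))
    → (∀ n i j → θ n i ≡ θ n j → i ≡ j)
    → (∀ n bs → AllowedCircuitFrom X (U n) bs → ∃[ i ] (θ n i ≡ bs))
    → (γ : (n : ℕ) → Fin (k (suc n)) → List (Fin (k n)))
    → (∀ n a → concatMap (θ n) (γ n a) ≡ θ (suc n) a)
    → ∀ (r : ℕ) → ∃[ d ] ∃[ a ] (d > 0 × (∀ c → ∃[ w ] (gammaComp k γ r d c ≡ w ++ [ a ])))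
lemma3p13 m X subshift minimal _ U |U| special grows k θ circuit θ-injective θ-onto γ θγ r =
  d , a₀ , z<s , ends-with-a₀
  where
  L = max 0 (tabulate (length ∘ θ r))
  d = suc L
  N = suc (d + r)

  fits : ∀ a → length (U r ++ θ r a) ≤ length (U N)
  fits a = begin
    length (U r ++ θ r a)          ≡⟨ length-++ (U r) ⟩
    length (U r) + length (θ r a)  ≡⟨ cong (_+ length (θ r a)) (|U| r) ⟩
    r + length (θ r a)             ≤⟨ +-monoʳ-≤ r (≤-max-tabulate (length ∘ θ r) a) ⟩
    r + L                          ≡⟨ +-comm r L ⟩
    L + r                          ≤⟨ ≤-trans (n≤1+n _) (n≤1+n _) ⟩
    N                              ≡⟨ |U| N ⟨
    length (U N)                   ∎
    where open ≤-Reasoning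

  unfold : ∀ c → concatMap (θ r) (gammaComp k γ r d c) ≡ θ N c
  unfold = concatMap-gammaComp k γ θ θγ r d

  last : ∀ c → ∃[ w ] ∃[ a ] (gammaComp k γ r d c ≡ w ∷ʳ a × (U r ++ θ r a) IsSuffixOf U N)
  last c = last-block-suffix (θ r) (circuit⇒returns ∘ circuit r) (suffix-chain U grows (suc d) r) fits
    (gammaComp k γ r d c) (λ empty → proj₁ (circuit N c) (trans (sym (unfold c)) (cong (concatMap (θ r)) empty)))
    (subst (ReturnsTo (U N)) (sym (unfold c)) (circuit⇒returns (circuit N c)))

  c₀ : Fin (k N)
  c₀ = proj₁ (θ-onto N _ (proj₂ (rightSpecial⇒circuit subshift minimal (special N))))

  a₀ : Fin (k r)
  a₀ = proj₁ (proj₂ (last c₀))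

  ends-with-a₀ : ∀ c → ∃[ w ] (gammaComp k γ r d c ≡ w ++ [ a₀ ])
  ends-with-a₀ c = let (w , a , eq , suffix) = last c in w , trans eq (cong (w ∷ʳ_) (θ-injective r a a₀
    (circuit-suffix-unique (circuit r a) (circuit r a₀) suffix (proj₂ (proj₂ (proj₂ (last c₀)))))))
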